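{- Let $p_1,\dots,p_n$ be distinct primes and $N=p_1^{\alpha_1}\cdots p_n^{\alpha_n}$ with $\alpha_1\ge \alpha_2\ge\cdots\ge \alpha_u>\alpha_{u+1}=\cdots =\alpha_n=1$ (where $u=0$ if all $\alpha_i=1$). Let $\mathcal T_1,\ldots,\mathcal T_k$ be all the sets $\mathcal T$ of positive divisors of $p_{u+1}\cdots p_n$ such that: (a) no two elements of $\mathcal T$ are coprime; (b) no element of $\mathcal T$ is divisible by another element of $\mathcal T$; (c) every divisor of $p_{u+1}\cdots p_n$ is either coprime to some element of $\mathcal T$ or divisible by some element of $\mathcal T$. Then $R(\mathcal T_1,N),\ldots,R(\mathcal T_k,N)$ are all the maximal $N$-sets with the minimum size; that is, a set of positive divisors of $N$ is a maximal $N$-set with the minimum size if and only if it equals $R(\mathcal T_i,N)$ for some $1\le i\le k$.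
   Context: A set $\mathcal D$ of positive divisors of $N$ is an $N$-set if no two elements of $\mathcal D$ are coprime; an $N$-set is maximal if no additional positive divisor of $N$ can be included in it while keeping the $N$-set property. "Maximal $N$-set with the minimum size" means a maximal $N$-set whose cardinality is the minimum of the cardinalities of all maximal $N$-sets (this minimum is known to equal $\alpha_n\prod_{i=1}^{n-1}(\alpha_i+1)$). For a set $\mathcal T$ of positive divisors of $N$, $R(\mathcal T,N)$ denotes the set of all positive divisors of $N$ that are divisible by at least one element of $\mathcal T$. -}

module Defs where

open import Data.Nat using (ℕ; zero; suc; _*_; _+_; _^_; _≤_; _<_; _≤ᵇ_; _≡ᵇ_)
open import Data.Nat.Divisibility using (_∣_; _∣?_)
open import Data.Nat.Coprimality using (Coprime)
open import Data.Bool using (Bool; true; false; if_then_else_; _∧_; _∨_)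
open import Data.Fin using (Fin; toℕ)
open import Data.List using (upTo)
open import Data.Bool.ListAction using (any)
open import Data.Product using (_×_; ∃)
open import Data.Sum using (_⊎_)
open import Relation.Nullary using (¬_)
open import Relation.Nullary.Decidable using (isYes)
open import Relation.Binary.PropositionalEquality using (_≡_)

prodFin : {n : ℕ} → (Fin n → ℕ) → ℕ
prodFin {zero}  f = 1
prodFin {suc n} f = f Fin.zero * prodFin (λ i → f (Fin.suc i))

bigN : {n : ℕ} → (Fin n → ℕ) → (Fin n → ℕ) → ℕ
bigN p α = prodFin (λ i → p i ^ α i)

-- M = p_{u+1} ⋯ p_n  (indices i with toℕ i ≥ u, 0-based)
bigM : {n : ℕ} → ℕ → (Fin n → ℕ) → ℕ
bigM u p = prodFin (λ i → if u ≤ᵇ toℕ i then p i else 1)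

DSet : Set
DSet = ℕ → Bool

_∈ₛ_ : ℕ → DSet → Set
d ∈ₛ D = D d ≡ true

SubsetDiv : ℕ → DSet → Set
SubsetDiv N D = ∀ d → d ∈ₛ D → d ∣ N

-- no two elements (not necessarily distinct) are coprime
NoCoprime : DSet → Set
NoCoprime D = ∀ a b → a ∈ₛ D → b ∈ₛ D → ¬ Coprime a b

IsNSet : ℕ → DSet → Set
IsNSet N D = SubsetDiv N D × NoCoprime D

insert : ℕ → DSet → DSet
insert d D x = D x ∨ (x ≡ᵇ d)

IsMaximalNSet : ℕ → DSet → Set
IsMaximalNSet N D =
  IsNSet N D × (∀ d → d ∣ N → IsNSet N (insert d D) → d ∈ₛ D)

countBelow : DSet → ℕ → ℕ
countBelow D zero    = 0
countBelow D (suc k) = (if D k then 1 else 0) + countBelow D k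

-- cardinality of a set of divisors of N (N ≥ 1, so all divisors are ≤ N)
size : ℕ → DSet → ℕ
size N D = countBelow D (suc N)

IsMinMaximalNSet : ℕ → DSet → Set
IsMinMaximalNSet N D =
  IsMaximalNSet N D × (∀ E → IsMaximalNSet N E → size N D ≤ size N E)

-- R(T,N): divisors of N divisible by some element of T
-- (any t ∣ d with d ≥ 1 satisfies t ≤ d, so searching t ∈ [0, d] suffices;
--  d = 0 is never a divisor of N ≥ 1)
R : DSet → ℕ → DSet
R T N d = isYes (d ∣? N) ∧ any (λ t → T t ∧ isYes (t ∣? d)) (upTo (suc d))

GoodT : ℕ → DSet → Set
GoodT M T =
  SubsetDiv M T
  × NoCoprime T
  × (∀ a b → a ∈ₛ T → b ∈ₛ T → a ∣ b → a ≡ b)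
  × (∀ d → d ∣ M →
       (∃ λ t → t ∈ₛ T × Coprime d t) ⊎ (∃ λ t → t ∈ₛ T × t ∣ d))

SameSet : DSet → DSet → Set
SameSet D E = ∀ d → D d ≡ E d

module Submission where

-- Write N = p₁^α₁ ⋯ pₙ^αₙ and M = p_{u+1} ⋯ pₙ, and let z ↦ N/z be the
-- complementation of divisors of N.  If D is a maximal N-set and z ∉ D, then z is
-- coprime to some e ∈ D, so N/z contains every prime of e and lies in D.  Thus
-- complementation maps the divisors outside D injectively into D, giving
-- |D| ≥ τ(N)/2, with equality exactly when D is complement-free (never contains
-- both z and N/z).  For T satisfying (a)-(c), R(T,N) is a maximal N-set, and it is
-- complement-free since any two members of T share a prime p_i with α_i = 1, which
-- cannot divide both z and N/z.  As T = {p_{u+1}} is such a set, the maximal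
-- N-sets of minimum size are exactly the complement-free ones.  Finally, a
-- complement-free maximal D contains gcd(x, M) for each x ∈ D, and so equals
-- R(T,N) for the set T of minimal members of D dividing M, which satisfies (a)-(c).

open import Defs
open import Data.Nat
  using (ℕ; zero; suc; _*_; _+_; _^_; _∸_; _≤_; _<_; _≤ᵇ_; _≡ᵇ_; z≤n; s≤s; s≤s⁻¹;
         _≟_; _≤?_; ≢-nonZero; nonTrivial⇒≢1)
open import Data.Nat.Properties
open import Data.Nat.Divisibility
open import Data.Nat.DivMod using (_/_; m*[n/m]≡n)
open import Data.Nat.GCD
open import Data.Nat.Coprimality using (Coprime; coprime?; gcd≡1⇒coprime) renaming (sym to coprime-sym)
open import Data.Nat.Primality
open import Data.Nat.Primality.Factorisation using (factorise; PrimeFactorisation)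
open import Data.Nat.ListAction using (product)
open import Data.Nat.Tactic.RingSolver using (solve-∀)
open import Data.Fin using (Fin; toℕ; fromℕ<)
open import Data.Fin.Properties using (toℕ-fromℕ<) renaming (suc-injective to Fin-suc-injective)
open import Data.List using ([]; _∷_; upTo)
open import Data.List.Membership.Propositional using (_∈_)
open import Data.List.Membership.Propositional.Properties using (∈-upTo⁺; ∈-upTo⁻)
open import Data.List.Relation.Unary.All using (All; _∷_)
open import Data.List.Relation.Unary.Any using (here; there)
open import Data.Bool using (Bool; true; false; _∧_; _∨_; not; T; if_then_else_)
open import Data.Bool.ListAction using (any)
open import Data.Product using (_×_; ∃; _,_; proj₁; proj₂)
open import Data.Sum using (_⊎_; inj₁; inj₂)
open import Data.Empty using (⊥; ⊥-elim)
open import Function.Definitions using (Injective)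
open import Relation.Nullary using (¬_; Dec; yes; no)
open import Relation.Nullary.Decidable using (isYes)
open import Relation.Binary.PropositionalEquality

true≢false : true ≢ false
true≢false ()

∧-true : ∀ {a b} → a ∧ b ≡ true → a ≡ true × b ≡ true
∧-true {true} {true} _ = refl , refl

∨-true : ∀ {a b} → a ∨ b ≡ true → a ≡ true ⊎ b ≡ true
∨-true {true}  _ = inj₁ refl
∨-true {false} e = inj₂ e

not-true : ∀ {b} → not b ≡ true → b ≡ false
not-true {false} _ = refl

≡ᵇ-true : ∀ {m n} → (m ≡ᵇ n) ≡ true → m ≡ n
≡ᵇ-true {m} {n} e = ≡ᵇ⇒≡ m n (subst T (sym e) _)

≡ᵇ-refl : ∀ n → (n ≡ᵇ n) ≡ true
≡ᵇ-refl zero    = refl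
≡ᵇ-refl (suc n) = ≡ᵇ-refl n

≡ᵇ-false : ∀ {m n} → m ≢ n → (m ≡ᵇ n) ≡ false
≡ᵇ-false {m} {n} m≢n with m ≡ᵇ n in eq
... | true  = ⊥-elim (m≢n (≡ᵇ-true eq))
... | false = refl

isYes-intro : ∀ {A : Set} (a? : Dec A) → A → isYes a? ≡ true
isYes-intro (yes _) _ = refl
isYes-intro (no ¬a) a = ⊥-elim (¬a a)

isYes-elim : ∀ {A : Set} (a? : Dec A) → isYes a? ≡ true → A
isYes-elim (yes a) _ = a

any-intro : ∀ (f : ℕ → Bool) xs x → x ∈ xs → f x ≡ true → any f xs ≡ true
any-intro f (y ∷ ys) x (here refl) fx rewrite fx = refl
any-intro f (y ∷ ys) x (there x∈ys) fx with f y
... | true  = refl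
... | false = any-intro f ys x x∈ys fx

any-elim : ∀ (f : ℕ → Bool) xs → any f xs ≡ true → ∃ λ x → x ∈ xs × f x ≡ true
any-elim f (y ∷ ys) h with f y in fy
... | true  = y , here refl , fy
... | false with any-elim f ys h
... | x , x∈ys , fx = x , there x∈ys , fx

search : (P : ℕ → Bool) → ∀ K →
  (∃ λ e → e < K × P e ≡ true) ⊎ (∀ e → e < K → P e ≡ false)
search P zero = inj₂ (λ e ())
search P (suc K) with P K in PK
... | true = inj₁ (K , ≤-refl , PK)
... | false with search P K
... | inj₁ (e , e<K , Pe) = inj₁ (e , m≤n⇒m≤1+n e<K , Pe)
... | inj₂ none = inj₂ λ e e<1+K → below-or-equal (m<1+n⇒m<n∨m≡n e<1+K)
  where
  below-or-equal : ∀ {e} → e < K ⊎ e ≡ K → P e ≡ false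
  below-or-equal (inj₁ e<K)  = none _ e<K
  below-or-equal (inj₂ refl) = PK

countBelow-cong : ∀ K (P Q : DSet) → (∀ z → z < K → P z ≡ Q z) →
  countBelow P K ≡ countBelow Q K
countBelow-cong zero    P Q h = refl
countBelow-cong (suc K) P Q h =
  cong₂ _+_ (cong (λ b → if b then 1 else 0) (h K ≤-refl))
            (countBelow-cong K P Q (λ z z<K → h z (m≤n⇒m≤1+n z<K)))

remove : DSet → ℕ → DSet
remove Q y z = Q z ∧ not (z ≡ᵇ y)

countBelow-remove : ∀ L (Q : DSet) y → y < L → y ∈ₛ Q →
  suc (countBelow (remove Q y) L) ≡ countBelow Q L
countBelow-remove (suc L) Q y y<1+L Qy with m<1+n⇒m<n∨m≡n y<1+L
... | inj₂ refl rewrite Qy | ≡ᵇ-refl y =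
  cong suc (countBelow-cong L (remove Q y) Q unchanged)
  where
  unchanged : ∀ z → z < y → remove Q y z ≡ Q z
  unchanged z z<y rewrite ≡ᵇ-false {z} {y} (λ e → <-irrefl e z<y) with Q z
  ... | true  = refl
  ... | false = refl
... | inj₁ y<L rewrite ≡ᵇ-false {L} {y} (λ e → <-irrefl (sym e) y<L) with Q L
... | true  = cong suc (countBelow-remove L Q y y<L Qy)
... | false = countBelow-remove L Q y y<L Qy

countBelow-injection : ∀ K L (P Q : DSet) (f : ℕ → ℕ) →
  (∀ x → x < K → x ∈ₛ P → f x ∈ₛ Q × f x < L) →
  (∀ x y → x ∈ₛ P → y ∈ₛ P → f x ≡ f y → x ≡ y) →
  countBelow P K ≤ countBelow Q L
countBelow-injection zero L P Q f maps inj = z≤n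
countBelow-injection (suc K) L P Q f maps inj with P K in PK
... | false = countBelow-injection K L P Q f (λ x x<K → maps x (m≤n⇒m≤1+n x<K)) inj
... | true  = begin
    suc (countBelow P K)                 ≤⟨ s≤s (countBelow-injection K L P Q' f maps' inj) ⟩
    suc (countBelow Q' L)                ≡⟨ countBelow-remove L Q (f K) fK<L QfK ⟩
    countBelow Q L                       ∎
  where
  open ≤-Reasoning
  Q' = remove Q (f K)
  QfK = proj₁ (maps K ≤-refl PK)
  fK<L = proj₂ (maps K ≤-refl PK)
  maps' : ∀ x → x < K → x ∈ₛ P → f x ∈ₛ Q' × f x < L
  maps' x x<K Px with maps x (m≤n⇒m≤1+n x<K) Px
  ... | Qfx , fx<L rewrite Qfx | ≡ᵇ-false {f x} {f K} (λ e → <-irrefl (inj x K Px PK e) x<K) =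
    refl , fx<L

countBelow-injection-missing : ∀ K L (P Q : DSet) (f : ℕ → ℕ) (y₀ : ℕ) →
  y₀ < L → y₀ ∈ₛ Q →
  (∀ x → x < K → x ∈ₛ P → f x ∈ₛ Q × f x < L) →
  (∀ x y → x ∈ₛ P → y ∈ₛ P → f x ≡ f y → x ≡ y) →
  (∀ x → x ∈ₛ P → f x ≢ y₀) →
  suc (countBelow P K) ≤ countBelow Q L
countBelow-injection-missing K L P Q f y₀ y₀<L Qy₀ maps inj misses =
  subst (suc (countBelow P K) ≤_) (countBelow-remove L Q y₀ y₀<L Qy₀)
    (s≤s (countBelow-injection K L P (remove Q y₀) f maps' inj))
  where
  maps' : ∀ x → x < K → x ∈ₛ P → f x ∈ₛ remove Q y₀ × f x < L
  maps' x x<K Px with maps x x<K Px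
  ... | Qfx , fx<L rewrite Qfx | ≡ᵇ-false (misses x Px) = refl , fx<L

countBelow-partition : ∀ K (P S : DSet) → (∀ x → x ∈ₛ P → x ∈ₛ S) →
  countBelow P K + countBelow (λ x → S x ∧ not (P x)) K ≡ countBelow S K
countBelow-partition zero    P S P⊆S = refl
countBelow-partition (suc K) P S P⊆S with P K in PK | S K in SK
... | true  | true  = cong suc (countBelow-partition K P S P⊆S)
... | true  | false = ⊥-elim (true≢false (trans (sym (P⊆S K PK)) SK))
... | false | false = countBelow-partition K P S P⊆S
... | false | true  =
  trans (+-suc (countBelow P K) _) (cong suc (countBelow-partition K P S P⊆S))

prime≢1 : ∀ {r} → Prime r → r ≢ 1
prime≢1 {r} (prime {{nt}} _) = nonTrivial⇒≢1 {r} {{nt}}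

prime≢0 : ∀ {r} → Prime r → r ≢ 0
prime≢0 {r} pr refl = ¬prime[0] pr

prime-∣-prime : ∀ {r q} → Prime r → Prime q → r ∣ q → r ≡ q
prime-∣-prime pr pq r∣q with prime⇒irreducible pq r∣q
... | inj₁ r≡1 = ⊥-elim (prime≢1 pr r≡1)
... | inj₂ r≡q = r≡q

prime-∣-pow : ∀ {r q} k → Prime r → Prime q → r ∣ q ^ k → r ≡ q
prime-∣-pow zero    pr pq r∣1 = ⊥-elim (prime≢1 pr (∣1⇒≡1 r∣1))
prime-∣-pow {q = q} (suc k) pr pq r∣qq^k with euclidsLemma q (q ^ k) pr r∣qq^k
... | inj₁ r∣q   = prime-∣-prime pr pq r∣q
... | inj₂ r∣q^k = prime-∣-pow k pr pq r∣q^k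

∣-pow : ∀ q k → 1 ≤ k → q ∣ q ^ k
∣-pow q (suc k) _ = m∣m*n _

prime-divisor : ∀ m → m ≢ 0 → m ≢ 1 → ∃ λ r → Prime r × r ∣ m
prime-divisor zero m≢0 m≢1 = ⊥-elim (m≢0 refl)
prime-divisor m@(suc _) m≢0 m≢1 =
  first (PrimeFactorisation.factors (factorise m))
        (PrimeFactorisation.isFactorisation (factorise m))
        (PrimeFactorisation.factorsPrime (factorise m))
  where
  first : ∀ rs → m ≡ product rs → All Prime rs → ∃ λ r → Prime r × r ∣ m
  first []       m≡1 _        = ⊥-elim (m≢1 m≡1)
  first (r ∷ rs) m≡  (pr ∷ _) = r , pr , subst (r ∣_) (sym m≡) (m∣m*n _)

common-prime⇒¬coprime : ∀ {r a b} → Prime r → r ∣ a → r ∣ b → ¬ Coprime a b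
common-prime⇒¬coprime pr r∣a r∣b cop = prime≢1 pr (cop (r∣a , r∣b))

¬coprime⇒common-prime : ∀ a b → a ≢ 0 → ¬ Coprime a b →
  ∃ λ r → Prime r × r ∣ a × r ∣ b
¬coprime⇒common-prime a b a≢0 ¬cop
  with prime-divisor (gcd a b) (gcd[m,n]≢0 a b (inj₁ a≢0)) (λ e → ¬cop (gcd≡1⇒coprime e))
... | r , pr , r∣g = r , pr , ∣-trans r∣g (gcd[m,n]∣m a b) , ∣-trans r∣g (gcd[m,n]∣n a b)

divisor≢0 : ∀ {d m} → m ≢ 0 → d ∣ m → d ≢ 0
divisor≢0 m≢0 d∣m refl = m≢0 (0∣⇒≡0 d∣m)

prodFin-cong : ∀ {k} (f g : Fin k → ℕ) → (∀ i → f i ≡ g i) → prodFin f ≡ prodFin g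
prodFin-cong {zero}  f g f≗g = refl
prodFin-cong {suc k} f g f≗g =
  cong₂ _*_ (f≗g Fin.zero) (prodFin-cong _ _ (λ j → f≗g (Fin.suc j)))

prodFin-* : ∀ {k} (f g : Fin k → ℕ) → prodFin (λ i → f i * g i) ≡ prodFin f * prodFin g
prodFin-* {zero}  f g = refl
prodFin-* {suc k} f g
  rewrite prodFin-* (λ j → f (Fin.suc j)) (λ j → g (Fin.suc j)) =
  interchange (f Fin.zero) (g Fin.zero) (prodFin (λ j → f (Fin.suc j))) (prodFin (λ j → g (Fin.suc j)))
  where
  interchange : ∀ a b c d → a * b * (c * d) ≡ a * c * (b * d)
  interchange = solve-∀

factor-∣-prodFin : ∀ {k} (f : Fin k → ℕ) i → f i ∣ prodFin f
factor-∣-prodFin f Fin.zero    = m∣m*n _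
factor-∣-prodFin f (Fin.suc i) = ∣n⇒∣m*n (f Fin.zero) (factor-∣-prodFin (λ j → f (Fin.suc j)) i)

prodFin-∣-mono : ∀ {k} (f g : Fin k → ℕ) → (∀ i → f i ∣ g i) → prodFin f ∣ prodFin g
prodFin-∣-mono {zero}  f g f∣g = ∣-refl
prodFin-∣-mono {suc k} f g f∣g = *-pres-∣ (f∣g Fin.zero) (prodFin-∣-mono _ _ (λ j → f∣g (Fin.suc j)))

prodFin≢0 : ∀ {k} (f : Fin k → ℕ) → (∀ i → f i ≢ 0) → prodFin f ≢ 0
prodFin≢0 {zero}  f f≢0 ()
prodFin≢0 {suc k} f f≢0 e with m*n≡0⇒m≡0∨n≡0 (f Fin.zero) e
... | inj₁ f0≡0 = f≢0 Fin.zero f0≡0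
... | inj₂ rest≡0 = prodFin≢0 (λ j → f (Fin.suc j)) (λ j → f≢0 (Fin.suc j)) rest≡0

prime-∣-prodFin : ∀ {k} (f : Fin k → ℕ) {r} → Prime r → r ∣ prodFin f → ∃ λ i → r ∣ f i
prime-∣-prodFin {zero} f pr r∣1 = ⊥-elim (prime≢1 pr (∣1⇒≡1 r∣1))
prime-∣-prodFin {suc k} f pr r∣∏ with euclidsLemma (f Fin.zero) (prodFin (λ j → f (Fin.suc j))) pr r∣∏
... | inj₁ r∣f0 = Fin.zero , r∣f0
... | inj₂ r∣rest with prime-∣-prodFin (λ j → f (Fin.suc j)) pr r∣rest
... | i , r∣fi = Fin.suc i , r∣fi

prodFin-split : ∀ {k} (f : Fin k → ℕ) i → ∃ λ K → prodFin f ≡ f i * K ×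
  (∀ {r} → Prime r → r ∣ K → ∃ λ j → j ≢ i × r ∣ f j)
prodFin-split f Fin.zero =
  prodFin (λ j → f (Fin.suc j)) , refl ,
  λ pr r∣K → let (j , r∣fj) = prime-∣-prodFin (λ j → f (Fin.suc j)) pr r∣K
             in Fin.suc j , (λ ()) , r∣fj
prodFin-split f (Fin.suc i) with prodFin-split (λ j → f (Fin.suc j)) i
... | K , ∏≡ , primes = f Fin.zero * K , ∏≡' , primes'
  where
  swap : ∀ a b c → a * (b * c) ≡ b * (a * c)
  swap = solve-∀
  ∏≡' : f Fin.zero * prodFin (λ j → f (Fin.suc j)) ≡ f (Fin.suc i) * (f Fin.zero * K)
  ∏≡' rewrite ∏≡ = swap (f Fin.zero) (f (Fin.suc i)) K
  primes' : ∀ {r} → Prime r → r ∣ f Fin.zero * K → ∃ λ j → j ≢ Fin.suc i × r ∣ f j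
  primes' pr r∣ with euclidsLemma (f Fin.zero) K pr r∣
  ... | inj₁ r∣f0 = Fin.zero , (λ ()) , r∣f0
  ... | inj₂ r∣K with primes pr r∣K
  ... | j , j≢i , r∣fj = Fin.suc j , (λ e → j≢i (Fin-suc-injective e)) , r∣fj

insert-new : ∀ d (D : DSet) → d ∈ₛ insert d D
insert-new d D rewrite ≡ᵇ-refl d with D d
... | true  = refl
... | false = refl

insert-old : ∀ {x} d (D : DSet) → x ∈ₛ D → x ∈ₛ insert d D
insert-old d D Dx rewrite Dx = refl

coprime-self⇒≡1 : ∀ {d} → Coprime d d → d ≡ 1
coprime-self⇒≡1 cop = cop (∣-refl , ∣-refl)

module ComplementArgument (N : ℕ) (N≢0 : N ≢ 0) (N≢1 : N ≢ 1) where

  divisor<1+N : ∀ {d} → d ∣ N → d < suc N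
  divisor<1+N d∣N = s≤s (∣⇒≤ {{≢-nonZero N≢0}} d∣N)

  member≢0 : ∀ {D d} → SubsetDiv N D → d ∈ₛ D → d ≢ 0
  member≢0 D⊆ Dd = divisor≢0 N≢0 (D⊆ _ Dd)

  insert-NSet : ∀ {D y} → IsNSet N D → y ∣ N → (∀ e → e ∈ₛ D → ¬ Coprime y e) →
    ¬ Coprime y y → IsNSet N (insert y D)
  insert-NSet {D} {y} (D⊆ , D-nc) y∣N y-nc y-nc-self = D⊆' , D-nc'
    where
    D⊆' : SubsetDiv N (insert y D)
    D⊆' d m with ∨-true {D d} m
    ... | inj₁ Dd = D⊆ d Dd
    ... | inj₂ e rewrite ≡ᵇ-true {d} {y} e = y∣N
    D-nc' : NoCoprime (insert y D)
    D-nc' a b ma mb with ∨-true {D a} ma | ∨-true {D b} mb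
    ... | inj₁ Da | inj₁ Db = D-nc a b Da Db
    ... | inj₁ Da | inj₂ eb rewrite ≡ᵇ-true {b} {y} eb = λ c → y-nc a Da (coprime-sym c)
    ... | inj₂ ea | inj₁ Db rewrite ≡ᵇ-true {a} {y} ea = y-nc b Db
    ... | inj₂ ea | inj₂ eb rewrite ≡ᵇ-true {a} {y} ea | ≡ᵇ-true {b} {y} eb = y-nc-self

  N-∈-maximal : ∀ {D} → IsMaximalNSet N D → N ∈ₛ D
  N-∈-maximal {D} (D-NSet , max) =
    max N ∣-refl (insert-NSet D-NSet ∣-refl N-nc (λ c → N≢1 (coprime-self⇒≡1 c)))
    where
    N-nc : ∀ e → e ∈ₛ D → ¬ Coprime N e
    N-nc e De c = proj₂ D-NSet e e De De (λ (k∣e , _) → c (∣-trans k∣e (proj₁ D-NSet e De) , k∣e))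

  excluded⇒coprime-member : ∀ {D d} → IsMaximalNSet N D → d ∣ N → D d ≡ false →
    ∃ λ e → e ∈ₛ D × Coprime d e
  excluded⇒coprime-member {D} {d} mD d∣N Dd with d ≟ 1
  ... | yes refl = N , N-∈-maximal mD , λ (k∣1 , _) → ∣1⇒≡1 k∣1
  ... | no d≢1 with search (λ e → D e ∧ isYes (coprime? d e)) (suc N)
  ... | inj₁ (e , _ , found) with ∧-true {D e} found
  ...   | De , cop = e , De , isYes-elim (coprime? d e) cop
  excluded⇒coprime-member {D} {d} mD@(D-NSet , max) d∣N Dd | no d≢1 | inj₂ none =
    ⊥-elim (true≢false (trans (sym d∈D) Dd))
    where
    d-nc : ∀ e → e ∈ₛ D → ¬ Coprime d e
    d-nc e De cop with none e (divisor<1+N (proj₁ D-NSet e De))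
    ... | notFound rewrite De | isYes-intro (coprime? d e) cop = true≢false notFound
    d∈D : d ∈ₛ D
    d∈D = max d d∣N (insert-NSet D-NSet d∣N d-nc (λ c → d≢1 (coprime-self⇒≡1 c)))

  maximal-prime-closed : ∀ {D x y} → IsMaximalNSet N D → x ∈ₛ D → y ∣ N →
    (∀ {r} → Prime r → r ∣ x → r ∣ y) → y ∈ₛ D
  maximal-prime-closed {D} {x} {y} (D-NSet@(D⊆ , D-nc) , max) Dx y∣N x⊑y =
    max y y∣N (insert-NSet D-NSet y∣N y-nc y-nc-self)
    where
    y-nc : ∀ e → e ∈ₛ D → ¬ Coprime y e
    y-nc e De with ¬coprime⇒common-prime x e (member≢0 D⊆ Dx) (D-nc x e Dx De)
    ... | r , pr , r∣x , r∣e = common-prime⇒¬coprime pr (x⊑y pr r∣x) r∣e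
    y-nc-self : ¬ Coprime y y
    y-nc-self with ¬coprime⇒common-prime x x (member≢0 D⊆ Dx) (D-nc x x Dx Dx)
    ... | r , pr , r∣x , _ = common-prime⇒¬coprime pr (x⊑y pr r∣x) (x⊑y pr r∣x)

  maximal-upward-closed : ∀ {D t y} → IsMaximalNSet N D → t ∈ₛ D → t ∣ y → y ∣ N → y ∈ₛ D
  maximal-upward-closed mD Dt t∣y y∣N = maximal-prime-closed mD Dt y∣N (λ _ r∣t → ∣-trans r∣t t∣y)

  co : ℕ → ℕ
  co zero    = 0
  co (suc k) = N / suc k

  co-spec : ∀ {z} → z ∣ N → z * co z ≡ N
  co-spec {zero}  0∣N = sym (0∣⇒≡0 0∣N)
  co-spec {suc k} z∣N = m*[n/m]≡n z∣N

  co-∣ : ∀ {z} → z ∣ N → co z ∣ N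
  co-∣ {z} z∣N = subst (co z ∣_) (co-spec z∣N) (n∣m*n z)

  co-unique : ∀ {z w} → z ∣ N → z * w ≡ N → w ≡ co z
  co-unique {z} {w} z∣N zw≡N =
    *-cancelˡ-≡ w (co z) z {{≢-nonZero (divisor≢0 N≢0 z∣N)}} (trans zw≡N (sym (co-spec z∣N)))

  co-injective : ∀ {x y} → x ∣ N → y ∣ N → co x ≡ co y → x ≡ y
  co-injective {x} {y} x∣N y∣N e =
    *-cancelʳ-≡ x y (co y) {{≢-nonZero (divisor≢0 N≢0 (co-∣ y∣N))}}
      (trans (subst (λ c → x * c ≡ N) e (co-spec x∣N)) (sym (co-spec y∣N)))

  maximal-complement : ∀ {D z} → IsMaximalNSet N D → z ∣ N → D z ≡ false → co z ∈ₛ D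
  maximal-complement {D} {z} mD z∣N Dz with excluded⇒coprime-member mD z∣N Dz
  ... | e , De , cop = maximal-prime-closed mD De (co-∣ z∣N) e⊑co
    where
    e⊑co : ∀ {r} → Prime r → r ∣ e → r ∣ co z
    e⊑co {r} pr r∣e with euclidsLemma z (co z) pr
      (subst (r ∣_) (sym (co-spec z∣N)) (∣-trans r∣e (proj₁ (proj₁ mD) e De)))
    ... | inj₁ r∣z  = ⊥-elim (common-prime⇒¬coprime pr r∣z r∣e cop)
    ... | inj₂ r∣co = r∣co

  ComplementFree : DSet → Set
  ComplementFree D = ∀ z → z ∣ N → z ∈ₛ D → co z ∈ₛ D → ⊥

  divisors : DSet
  divisors x = isYes (x ∣? N)

  outside : DSet → DSet
  outside D x = divisors x ∧ not (D x)

  outside-elim : ∀ {D x} → x ∈ₛ outside D → x ∣ N × D x ≡ false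
  outside-elim {D} {x} h with ∧-true {divisors x} h
  ... | x∣N , ¬Dx = isYes-elim (x ∣? N) x∣N , not-true ¬Dx

  size-partition : ∀ {D} → SubsetDiv N D → size N D + size N (outside D) ≡ size N divisors
  size-partition {D} D⊆ =
    countBelow-partition (suc N) D divisors (λ x Dx → isYes-intro (x ∣? N) (D⊆ x Dx))

  outside-injects : ∀ {D} → IsMaximalNSet N D →
    ∀ x → x < suc N → x ∈ₛ outside D → co x ∈ₛ D × co x < suc N
  outside-injects {D} mD x _ out with outside-elim {D} {x} out
  ... | x∣N , Dx = maximal-complement mD x∣N Dx , divisor<1+N (co-∣ x∣N)

  co-injective-outside : ∀ {D} x y → x ∈ₛ outside D → y ∈ₛ outside D → co x ≡ co y → x ≡ y
  co-injective-outside {D} x y outx outy =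
    co-injective (proj₁ (outside-elim {D} outx)) (proj₁ (outside-elim {D} outy))

  size-outside≤size : ∀ {D} → IsMaximalNSet N D → size N (outside D) ≤ size N D
  size-outside≤size {D} mD = countBelow-injection (suc N) (suc N) (outside D) D co
    (outside-injects mD) (co-injective-outside {D})

  size≤size-outside : ∀ {D} → SubsetDiv N D → ComplementFree D → size N D ≤ size N (outside D)
  size≤size-outside {D} D⊆ free = countBelow-injection (suc N) (suc N) D (outside D) co
    maps (λ x y Dx Dy → co-injective (D⊆ x Dx) (D⊆ y Dy))
    where
    maps : ∀ x → x < suc N → x ∈ₛ D → co x ∈ₛ outside D × co x < suc N
    maps x _ Dx with D (co x) in Dco
    ... | true  = ⊥-elim (free x (D⊆ x Dx) Dx Dco)
    ... | false rewrite isYes-intro (co x ∣? N) (co-∣ (D⊆ x Dx)) = refl , divisor<1+N (co-∣ (D⊆ x Dx))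

  -- If a maximal D contains some z with its complement, then z is missed by the
  -- injection and the inequality is strict.
  size-outside<size : ∀ {D z} → IsMaximalNSet N D → z ∣ N → z ∈ₛ D → co z ∈ₛ D →
    suc (size N (outside D)) ≤ size N D
  size-outside<size {D} {z} mD z∣N Dz Dco =
    countBelow-injection-missing (suc N) (suc N) (outside D) D co z (divisor<1+N z∣N) Dz
      (outside-injects mD) (co-injective-outside {D}) misses
    where
    misses : ∀ x → x ∈ₛ outside D → co x ≢ z
    misses x out cox≡z with outside-elim {D} out
    ... | x∣N , Dx = true≢false (trans (sym Dco) (trans (cong D (sym x≡coz)) Dx))
      where
      x≡coz : x ≡ co z
      x≡coz = co-unique z∣N (trans (*-comm z x) (subst (λ c → x * c ≡ N) cox≡z (co-spec x∣N)))

  complementFree⇒minimum : ∀ {D E} → IsMaximalNSet N D → ComplementFree D → IsMaximalNSet N E →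
    size N D ≤ size N E
  complementFree⇒minimum {D} {E} mD free mE = half-below-half
      (size≤size-outside D⊆ free) (size-outside≤size mE)
      (trans (size-partition D⊆) (sym (size-partition (proj₁ (proj₁ mE)))))
    where
    D⊆ = proj₁ (proj₁ mD)
    half-below-half : ∀ {a a' c c'} → a ≤ a' → c' ≤ c → a + a' ≡ c + c' → a ≤ c
    half-below-half {a} {a'} {c} {c'} a≤a' c'≤c sum≡ with a ≤? c
    ... | yes a≤c = a≤c
    ... | no a≰c = ⊥-elim (<-irrefl (sym sum≡) (begin-strict
          c + c' ≤⟨ +-monoʳ-≤ c c'≤c ⟩
          c + c  <⟨ +-mono-<-≤ (≰⇒> a≰c) (<⇒≤ (<-≤-trans (≰⇒> a≰c) a≤a')) ⟩
          a + a' ∎))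
      where open ≤-Reasoning

  minimum⇒complementFree : ∀ {D E} → IsMaximalNSet N D → IsMaximalNSet N E → ComplementFree E →
    size N D ≤ size N E → ComplementFree D
  minimum⇒complementFree {D} {E} mD mE freeE D≤E z z∣N Dz Dco =
    <-irrefl (trans (size-partition D⊆) (sym (size-partition E⊆)))
      (+-mono-≤-< D≤E (<-≤-trans (size-outside<size mD z∣N Dz Dco)
                                 (≤-trans D≤E (size≤size-outside E⊆ freeE))))
    where
    D⊆ = proj₁ (proj₁ mD)
    E⊆ = proj₁ (proj₁ mE)

  R-intro : ∀ {T d t} → d ∣ N → t ∈ₛ T → t ∣ d → d ∈ₛ R T N
  R-intro {T} {d} {t} d∣N Tt t∣d rewrite isYes-intro (d ∣? N) d∣N =
    any-intro (λ t → T t ∧ isYes (t ∣? d)) (upTo (suc d)) t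
      (∈-upTo⁺ (s≤s (∣⇒≤ {{≢-nonZero (divisor≢0 N≢0 d∣N)}} t∣d)))
      (cong₂ _∧_ Tt (isYes-intro (t ∣? d) t∣d))

  R-elim : ∀ {T d} → d ∈ₛ R T N → d ∣ N × ∃ λ t → t ∈ₛ T × t ∣ d
  R-elim {T} {d} h with ∧-true {isYes (d ∣? N)} h
  ... | d∣N , found with any-elim (λ t → T t ∧ isYes (t ∣? d)) (upTo (suc d)) found
  ... | t , _ , Tt∧t∣d with ∧-true {T t} Tt∧t∣d
  ... | Tt , t∣d = isYes-elim (d ∣? N) d∣N , t , Tt , isYes-elim (t ∣? d) t∣d

  NSet-cong : ∀ {A B} → SameSet A B → IsNSet N A → IsNSet N B
  NSet-cong A≐B (A⊆ , A-nc) =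
    (λ d Bd → A⊆ d (trans (A≐B d) Bd)) ,
    (λ a b Ba Bb → A-nc a b (trans (A≐B a) Ba) (trans (A≐B b) Bb))

  maximal-cong : ∀ {D E} → SameSet D E → IsMaximalNSet N E → IsMaximalNSet N D
  maximal-cong {D} {E} D≐E (E-NSet , max) =
    NSet-cong (λ x → sym (D≐E x)) E-NSet ,
    λ d d∣N D+d → trans (D≐E d) (max d d∣N (NSet-cong (λ x → cong (_∨ (x ≡ᵇ d)) (D≐E x)) D+d))

  module Generated (M : ℕ) (M∣N : M ∣ N) (T : DSet) (good : GoodT M T) where

    private
      T⊆ = proj₁ good
      T-nc = proj₁ (proj₂ good)
      T-covers = proj₂ (proj₂ (proj₂ good))
      M≢0 = divisor≢0 N≢0 M∣N

    T∈R : ∀ {t} → t ∈ₛ T → t ∈ₛ R T N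
    T∈R Tt = R-intro (∣-trans (T⊆ _ Tt) M∣N) Tt ∣-refl

    R-NSet : IsNSet N (R T N)
    R-NSet = (λ d Rd → proj₁ (R-elim {T} Rd)) , R-nc
      where
      R-nc : NoCoprime (R T N)
      R-nc a b Ra Rb with R-elim {T} Ra | R-elim {T} Rb
      ... | _ , ta , Tta , ta∣a | _ , tb , Ttb , tb∣b
        with ¬coprime⇒common-prime ta tb (divisor≢0 M≢0 (T⊆ _ Tta)) (T-nc ta tb Tta Ttb)
      ... | r , pr , r∣ta , r∣tb = common-prime⇒¬coprime pr (∣-trans r∣ta ta∣a) (∣-trans r∣tb tb∣b)

    -- By (c) applied to gcd(d, M), a divisor d is either above a member of T or
    -- coprime to one; in the latter case it cannot be added.
    R-maximal : IsMaximalNSet N (R T N)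
    R-maximal = R-NSet , max
      where
      max : ∀ d → d ∣ N → IsNSet N (insert d (R T N)) → d ∈ₛ R T N
      max d d∣N (_ , R+d-nc) with T-covers (gcd d M) (gcd[m,n]∣n d M)
      ... | inj₂ (t , Tt , t∣g) = R-intro d∣N Tt (∣-trans t∣g (gcd[m,n]∣m d M))
      ... | inj₁ (t , Tt , g-cop-t) =
        ⊥-elim (R+d-nc d t (insert-new d (R T N)) (insert-old d (R T N) (T∈R Tt)) d-cop-t)
        where
        d-cop-t : Coprime d t
        d-cop-t (k∣d , k∣t) = g-cop-t (gcd-greatest k∣d (∣-trans k∣t (T⊆ t Tt)) , k∣t)

    -- Two members of T share a prime r ∣ M; it would divide both z and N/z.
    R-complementFree : (∀ {r} → Prime r → r ∣ M → ¬ (r * r ∣ N)) → ComplementFree (R T N)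
    R-complementFree simple z z∣N Rz Rco with R-elim {T} Rz | R-elim {T} Rco
    ... | _ , t , Tt , t∣z | _ , t' , Tt' , t'∣co
      with ¬coprime⇒common-prime t t' (divisor≢0 M≢0 (T⊆ t Tt)) (T-nc t t' Tt Tt')
    ... | r , pr , r∣t , r∣t' =
      simple pr (∣-trans r∣t (T⊆ t Tt))
        (subst (r * r ∣_) (co-spec z∣N) (*-pres-∣ (∣-trans r∣t t∣z) (∣-trans r∣t' t'∣co)))

-- The divisors of N = ∏ pᵢ^αᵢ, where (indexing from 0) αᵢ ≥ 2 for i < u and αᵢ = 1
-- otherwise.
module PrimePowerDivisors (n u : ℕ) (p α : Fin n → ℕ)
  (p-prime : ∀ i → Prime (p i)) (p-injective : Injective _≡_ _≡_ p) (u<n : u < n)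
  (α-low : ∀ i → toℕ i < u → 2 ≤ α i) (α-high : ∀ i → u ≤ toℕ i → α i ≡ 1) where

  N : ℕ
  N = bigN p α

  M : ℕ
  M = bigM u p

  Mfactor : Fin n → ℕ
  Mfactor i = if u ≤ᵇ toℕ i then p i else 1

  data Side (i : Fin n) : Set where
    high : u ≤ toℕ i → (u ≤ᵇ toℕ i) ≡ true → Side i
    low  : toℕ i < u → (u ≤ᵇ toℕ i) ≡ false → Side i

  side : ∀ i → Side i
  side i with u ≤ᵇ toℕ i in e
  ... | true  = high (≤ᵇ⇒≤ u (toℕ i) (subst T (sym e) _)) e
  ... | false = low (≰⇒> (λ le → subst T e (≤⇒≤ᵇ le))) e

  α≥1 : ∀ i → 1 ≤ α i
  α≥1 i with side i
  ... | high le _ = ≤-reflexive (sym (α-high i le))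
  ... | low lt _  = ≤-trans (s≤s z≤n) (α-low i lt)

  N≢0 : N ≢ 0
  N≢0 = prodFin≢0 _ (λ i e → prime≢0 (p-prime i) (m^n≡0⇒m≡0 (p i) (α i) e))

  p∣N : ∀ i → p i ∣ N
  p∣N i = ∣-trans (∣-pow (p i) (α i) (α≥1 i)) (factor-∣-prodFin (λ j → p j ^ α j) i)

  -- The hypothesis u < n guarantees that the index u exists: p_{u+1} in the
  -- paper's 1-based numbering, a prime factor of M.
  iᵤ : Fin n
  iᵤ = fromℕ< u<n

  iᵤ-high : u ≤ toℕ iᵤ
  iᵤ-high = ≤-reflexive (sym (toℕ-fromℕ< u<n))

  N≢1 : N ≢ 1
  N≢1 N≡1 = prime≢1 (p-prime iᵤ) (∣1⇒≡1 (subst (p iᵤ ∣_) N≡1 (p∣N iᵤ)))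

  M∣N : M ∣ N
  M∣N = prodFin-∣-mono Mfactor (λ i → p i ^ α i) factor-∣
    where
    factor-∣ : ∀ i → Mfactor i ∣ p i ^ α i
    factor-∣ i with side i
    ... | high _ e rewrite e = ∣-pow (p i) (α i) (α≥1 i)
    ... | low _ e  rewrite e = 1∣ _

  p∣M : ∀ i → u ≤ toℕ i → p i ∣ M
  p∣M i le with side i | factor-∣-prodFin Mfactor i
  ... | high _ e | pᵢ∣M rewrite e = pᵢ∣M
  ... | low lt _ | _ = ⊥-elim (<-irrefl refl (<-≤-trans lt le))

  prime-∣-N : ∀ {r} → Prime r → r ∣ N → ∃ λ i → r ≡ p i
  prime-∣-N pr r∣N with prime-∣-prodFin (λ j → p j ^ α j) pr r∣N
  ... | i , r∣pᵢ^αᵢ = i , prime-∣-pow (α i) pr (p-prime i) r∣pᵢ^αᵢ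

  prime-∣-M : ∀ {r} → Prime r → r ∣ M → ∃ λ i → u ≤ toℕ i × r ≡ p i
  prime-∣-M {r} pr r∣M with prime-∣-prodFin Mfactor pr r∣M
  ... | i , r∣factor with side i
  ... | high le e rewrite e = i , le , prime-∣-prime pr (p-prime i) r∣factor
  ... | low _ e   rewrite e = ⊥-elim (prime≢1 pr (∣1⇒≡1 r∣factor))

  -- The primes of M occur in N to the first power only (this uses that the pᵢ are distinct).
  M-simple : ∀ {r} → Prime r → r ∣ M → ¬ (r * r ∣ N)
  M-simple pr r∣M rr∣N with prime-∣-M pr r∣M
  ... | i , le , refl with prodFin-split (λ j → p j ^ α j) i
  ... | K , N≡ , K-primes
    with K-primes (p-prime i) (*-cancelˡ-∣ (p i) {{≢-nonZero (prime≢0 (p-prime i))}} pp∣pK)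
    where
    pᵢ^αᵢ≡pᵢ : p i ^ α i ≡ p i
    pᵢ^αᵢ≡pᵢ = trans (cong (p i ^_) (α-high i le)) (*-identityʳ (p i))
    pp∣pK : p i * p i ∣ p i * K
    pp∣pK = subst (p i * p i ∣_) (trans N≡ (cong (_* K) pᵢ^αᵢ≡pᵢ)) rr∣N
  ... | j , j≢i , pᵢ∣pⱼ^αⱼ =
    j≢i (sym (p-injective (prime-∣-pow (α j) (p-prime i) (p-prime j) pᵢ∣pⱼ^αⱼ)))

  open ComplementArgument N N≢0 N≢1

  single : DSet
  single x = x ≡ᵇ p iᵤ

  single-good : GoodT M single
  single-good = single⊆ , single-nc , single-antichain , single-covers
    where
    pᵤ-prime = p-prime iᵤ
    single⊆ : SubsetDiv M single
    single⊆ x e rewrite ≡ᵇ-true {x} e = p∣M iᵤ iᵤ-high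
    single-nc : NoCoprime single
    single-nc a b ea eb cop rewrite ≡ᵇ-true {a} ea | ≡ᵇ-true {b} eb =
      prime≢1 pᵤ-prime (coprime-self⇒≡1 cop)
    single-antichain : ∀ a b → a ∈ₛ single → b ∈ₛ single → a ∣ b → a ≡ b
    single-antichain a b ea eb _ = trans (≡ᵇ-true {a} ea) (sym (≡ᵇ-true {b} eb))
    single-covers : ∀ d → d ∣ M →
      (∃ λ t → t ∈ₛ single × Coprime d t) ⊎ (∃ λ t → t ∈ₛ single × t ∣ d)
    single-covers d _ with p iᵤ ∣? d
    ... | yes pᵤ∣d = inj₂ (p iᵤ , ≡ᵇ-refl (p iᵤ) , pᵤ∣d)
    ... | no pᵤ∤d  = inj₁ (p iᵤ , ≡ᵇ-refl (p iᵤ) , d-cop-pᵤ)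
      where
      d-cop-pᵤ : Coprime d (p iᵤ)
      d-cop-pᵤ (k∣d , k∣pᵤ) with prime⇒irreducible pᵤ-prime k∣pᵤ
      ... | inj₁ k≡1 = k≡1
      ... | inj₂ refl = ⊥-elim (pᵤ∤d k∣d)

  single-maximal : IsMaximalNSet N (R single N)
  single-maximal = Generated.R-maximal M M∣N single single-good

  single-complementFree : ComplementFree (R single N)
  single-complementFree = Generated.R-complementFree M M∣N single single-good M-simple

  -- For a divisor x, split N = z · w: z takes pᵢ for every i < u and, above u,
  -- exactly the primes of x; w takes the remaining factors.
  part copart : ℕ → Fin n → ℕ
  part   x i = if u ≤ᵇ toℕ i then (if isYes (p i ∣? x) then p i else 1) else p i
  copart x i = if u ≤ᵇ toℕ i then (if isYes (p i ∣? x) then 1 else p i) else p i ^ (α i ∸ 1)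

  part*copart≡N : ∀ x → prodFin (part x) * prodFin (copart x) ≡ N
  part*copart≡N x = trans (sym (prodFin-* (part x) (copart x))) (prodFin-cong _ _ factorwise)
    where
    factorwise : ∀ i → part x i * copart x i ≡ p i ^ α i
    factorwise i with side i
    ... | low _ e rewrite e with α i | α≥1 i
    ...   | suc k | _ = refl
    factorwise i | high le e rewrite e | α-high i le with p i ∣? x
    ... | yes _ = refl
    ... | no _  = *-comm 1 (p i)

  part-contains : ∀ {x} → x ∣ N → ∀ {r} → Prime r → r ∣ x → r ∣ prodFin (part x)
  part-contains {x} x∣N {r} pr r∣x with prime-∣-N pr (∣-trans r∣x x∣N)
  ... | i , refl = ∣-trans (pᵢ∣partᵢ (side i)) (factor-∣-prodFin (part x) i)
    where
    pᵢ∣partᵢ : Side i → p i ∣ part x i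
    pᵢ∣partᵢ (high _ e) rewrite e | isYes-intro (p i ∣? x) r∣x = ∣-refl
    pᵢ∣partᵢ (low _ e)  rewrite e = ∣-refl

  -- w contains every prime of a divisor e of N coprime to gcd(x, M); below u this
  -- uses αᵢ ≥ 2.
  copart-contains : ∀ {x e} → e ∣ N → Coprime (gcd x M) e →
    ∀ {r} → Prime r → r ∣ e → r ∣ prodFin (copart x)
  copart-contains {x} {e} e∣N cop {r} pr r∣e with prime-∣-N pr (∣-trans r∣e e∣N)
  ... | i , refl = ∣-trans (pᵢ∣copartᵢ (side i)) (factor-∣-prodFin (copart x) i)
    where
    pᵢ∣copartᵢ : Side i → p i ∣ copart x i
    pᵢ∣copartᵢ (high le e) rewrite e with p i ∣? x
    ... | yes pᵢ∣x = ⊥-elim (prime≢1 pr (cop (gcd-greatest pᵢ∣x (p∣M i le) , r∣e)))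
    ... | no _     = ∣-refl
    pᵢ∣copartᵢ (low lt e) rewrite e =
      ∣-pow (p i) (α i ∸ 1) (∸-monoˡ-≤ 1 (α-low i lt))

  module ComplementFreeStructure (D : DSet) (mD : IsMaximalNSet N D) (free : ComplementFree D) where

    private
      D⊆ = proj₁ (proj₁ mD)
      D-nc = proj₂ (proj₁ mD)

    -- If gcd(x, M) ∉ D, some e ∈ D is coprime to it; then z ∈ D (from x) and
    -- w = N/z ∈ D (from e), contradicting complement-freeness.
    gcd-closed : ∀ {x} → x ∈ₛ D → gcd x M ∈ₛ D
    gcd-closed {x} Dx with D (gcd x M) in Dg
    ... | true = refl
    ... | false with excluded⇒coprime-member mD (∣-trans (gcd[m,n]∣n x M) M∣N) Dg
    ... | e , De , cop = ⊥-elim (free z z∣N Dz (subst (_∈ₛ D) (co-unique z∣N (part*copart≡N x)) Dw))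
      where
      z = prodFin (part x)
      w = prodFin (copart x)
      z∣N : z ∣ N
      z∣N = subst (z ∣_) (part*copart≡N x) (m∣m*n w)
      w∣N : w ∣ N
      w∣N = subst (w ∣_) (part*copart≡N x) (n∣m*n z)
      Dz : z ∈ₛ D
      Dz = maximal-prime-closed mD Dx z∣N (part-contains (D⊆ x Dx))
      Dw : w ∈ₛ D
      Dw = maximal-prime-closed mD De w∣N (copart-contains (D⊆ e De) cop)

    hasSmallerDivisor : ℕ → Bool
    hasSmallerDivisor t = any (λ s → D s ∧ isYes (s ∣? t)) (upTo t)

    generators : DSet
    generators t = D t ∧ (isYes (t ∣? M) ∧ not (hasSmallerDivisor t))

    generators-intro : ∀ {d} → d ∈ₛ D → d ∣ M → hasSmallerDivisor d ≡ false → d ∈ₛ generators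
    generators-intro {d} Dd d∣M minimal rewrite Dd | isYes-intro (d ∣? M) d∣M | minimal = refl

    generators-elim : ∀ {t} → t ∈ₛ generators → t ∈ₛ D × t ∣ M × hasSmallerDivisor t ≡ false
    generators-elim {t} h with ∧-true {D t} h
    ... | Dt , rest with ∧-true {isYes (t ∣? M)} rest
    ... | t∣M , minimal = Dt , isYes-elim (t ∣? M) t∣M , not-true minimal

    descent : ∀ k d → d < k → d ∈ₛ D → d ∣ M → ∃ λ t → t ∈ₛ generators × t ∣ d
    descent (suc k) d d<1+k Dd d∣M with hasSmallerDivisor d in smaller
    ... | false = d , generators-intro Dd d∣M smaller , ∣-refl
    ... | true with any-elim (λ s → D s ∧ isYes (s ∣? d)) (upTo d) smaller
    ... | s , s∈ , Ds∧s∣d with ∧-true {D s} Ds∧s∣d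
    ... | Ds , s∣d? with isYes-elim (s ∣? d) s∣d?
    ... | s∣d with descent k s (<-≤-trans (∈-upTo⁻ s∈) (s≤s⁻¹ d<1+k)) Ds (∣-trans s∣d d∣M)
    ... | t , Gt , t∣s = t , Gt , ∣-trans t∣s s∣d

    above-generator : ∀ {d} → d ∈ₛ D → d ∣ M → ∃ λ t → t ∈ₛ generators × t ∣ d
    above-generator {d} = descent (suc d) d ≤-refl

    member-above-generator : ∀ {x} → x ∈ₛ D → ∃ λ t → t ∈ₛ generators × t ∣ x
    member-above-generator {x} Dx with above-generator (gcd-closed Dx) (gcd[m,n]∣n x M)
    ... | t , Gt , t∣g = t , Gt , ∣-trans t∣g (gcd[m,n]∣m x M)

    generators-good : GoodT M generators
    generators-good = G⊆ , G-nc , G-antichain , G-covers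
      where
      G⊆ : SubsetDiv M generators
      G⊆ t Gt = proj₁ (proj₂ (generators-elim Gt))
      G-nc : NoCoprime generators
      G-nc a b Ga Gb = D-nc a b (proj₁ (generators-elim Ga)) (proj₁ (generators-elim Gb))
      G-antichain : ∀ a b → a ∈ₛ generators → b ∈ₛ generators → a ∣ b → a ≡ b
      G-antichain a b Ga Gb a∣b with a ≟ b
      ... | yes a≡b = a≡b
      ... | no a≢b  = ⊥-elim (true≢false (trans (sym b-not-minimal) (proj₂ (proj₂ (generators-elim Gb)))))
        where
        Da = proj₁ (generators-elim Ga)
        Db = proj₁ (generators-elim Gb)
        a<b : a < b
        a<b = ≤∧≢⇒< (∣⇒≤ {{≢-nonZero (member≢0 D⊆ Db)}} a∣b) a≢b
        b-not-minimal : hasSmallerDivisor b ≡ true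
        b-not-minimal = any-intro (λ s → D s ∧ isYes (s ∣? b)) (upTo b) a (∈-upTo⁺ a<b)
                          (cong₂ _∧_ Da (isYes-intro (a ∣? b) a∣b))
      -- d ∈ D is above a generator; d ∉ D is coprime to some e ∈ D, hence to the
      -- generator below e
      G-covers : ∀ d → d ∣ M →
        (∃ λ t → t ∈ₛ generators × Coprime d t) ⊎ (∃ λ t → t ∈ₛ generators × t ∣ d)
      G-covers d d∣M with D d in Dd
      ... | true = inj₂ (above-generator Dd d∣M)
      ... | false with excluded⇒coprime-member mD (∣-trans d∣M M∣N) Dd
      ... | e , De , d-cop-e with member-above-generator De
      ... | t , Gt , t∣e = inj₁ (t , Gt , λ (k∣d , k∣t) → d-cop-e (k∣d , ∣-trans k∣t t∣e))

    D≐R : SameSet D (R generators N)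
    D≐R x with D x in Dx
    ... | true with member-above-generator Dx
    ...   | t , Gt , t∣x = sym (R-intro (D⊆ x Dx) Gt t∣x)
    D≐R x | false with R generators N x in Rx
    ... | false = refl
    ... | true with R-elim {generators} Rx
    ...   | x∣N , t , Gt , t∣x =
      ⊥-elim (true≢false (trans (sym (maximal-upward-closed mD (proj₁ (generators-elim Gt)) t∣x x∣N)) Dx))

theorem3 : (n u : ℕ) (p α : Fin n → ℕ)
    → (∀ i → Prime (p i))
    → Injective _≡_ _≡_ p
    → u < n
    → (∀ i j → toℕ i ≤ toℕ j → α j ≤ α i)
    → (∀ i → toℕ i < u → 2 ≤ α i)
    → (∀ i → u ≤ toℕ i → α i ≡ 1)
    → (D : DSet) → SubsetDiv (bigN p α) D
    → (IsMinMaximalNSet (bigN p α) D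
    → ∃ λ T → GoodT (bigM u p) T × SameSet D (R T (bigN p α)))
    × ((∃ λ T → GoodT (bigM u p) T × SameSet D (R T (bigN p α)))
    → IsMinMaximalNSet (bigN p α) D)
theorem3 n u p α p-prime p-injective u<n _ α-low α-high D _ = minimum⇒generated , generated⇒minimum
  where
  open PrimePowerDivisors n u p α p-prime p-injective u<n α-low α-high
  open ComplementArgument N N≢0 N≢1

  minimum⇒generated : IsMinMaximalNSet N D → ∃ λ T → GoodT M T × SameSet D (R T N)
  minimum⇒generated (mD , least) = generators , generators-good , D≐R
    where
    free : ComplementFree D
    free = minimum⇒complementFree mD single-maximal single-complementFree (least _ single-maximal)
    open ComplementFreeStructure D mD free

  generated⇒minimum : (∃ λ T → GoodT M T × SameSet D (R T N)) → IsMinMaximalNSet N D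
  generated⇒minimum (T , good , D≐R) = mD , λ E mE → complementFree⇒minimum mD free mE
    where
    open Generated M M∣N T good
    mD : IsMaximalNSet N D
    mD = maximal-cong D≐R R-maximal
    free : ComplementFree D
    free z z∣N Dz Dco =
      R-complementFree M-simple z z∣N (trans (sym (D≐R z)) Dz) (trans (sym (D≐R (co z))) Dco)
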